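{- Fix an integer $b>4$ and an integer $k$. The total degree of all nodes in every $(b,k)$-overslack tree of height $h$ equals $D(h,k)$, where $D(0,k)=k$ and $D(h,k)=k+b\,(d(h-1,k)-1)$ for $h>0$. Moreover, $D(h,k)$ is increasing in $h$ and in $k$ (as a function of integers $h\ge0$ and $k\ge2$).
   Context: Leaf-oriented search trees store keys in leaves; the degree of an internal node is its number of non-nil child pointers and the degree of a leaf is its number of keys; a node of degree $b-x$ contains $x$ units of slack. Height is the depth of the leaves (root at depth 0). A $(b,k)$-overslack tree is a leaf-oriented search tree whose root has degree $k$, in which all leaves have the same depth, every internal node has between $2$ and $b$ child pointers, every leaf has between $0$ and $b$ keys, and for every internal node $u$ the children of $u$ contain a total of exactly $b$ slack. The function $d$ is defined by $d(0,k)=k$, $d(1,k)=kb-b$, and $d(\delta,k)=b\,(d(\delta-1,k)-d(\delta-2,k))$ for $\delta\ge2$. -}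

module Defs where

open import Data.Nat using (ℕ; zero; suc; _≤_; _∸_)
open import Data.List using (List; []; _∷_; length)
open import Data.List.Relation.Unary.All using (All)
open import Data.Product using (_×_)
open import Data.Integer using (ℤ; +_; _-_) renaming (_+_ to _+ℤ_; _*_ to _*ℤ_)
open import Relation.Binary.PropositionalEquality using (_≡_)
import Data.Nat as ℕ

-- Shape of a leaf-oriented search tree: leaves hold (a list of) keys,
-- internal nodes hold the list of their non-nil child pointers.
data Tree : Set where
  leaf : List ℕ → Tree
  node : List Tree → Tree

deg : Tree → ℕ
deg (leaf ks) = length ks
deg (node ts) = length ts

mutual
  totalDeg : Tree → ℕ
  totalDeg (leaf ks) = length ks
  totalDeg (node ts) = length ts ℕ.+ totalDegs ts

  totalDegs : List Tree → ℕ
  totalDegs []       = 0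
  totalDegs (t ∷ ts) = totalDeg t ℕ.+ totalDegs ts

slackSum : ℕ → List Tree → ℕ
slackSum b []       = 0
slackSum b (t ∷ ts) = (b ∸ deg t) ℕ.+ slackSum b ts

data LeavesAt : ℕ → Tree → Set where
  leafAt : ∀ {ks} → LeavesAt 0 (leaf ks)
  nodeAt : ∀ {h ts} → All (LeavesAt h) ts → LeavesAt (suc h) (node ts)

data Valid (b : ℕ) : Tree → Set where
  leafV : ∀ {ks} → length ks ≤ b → Valid b (leaf ks)
  nodeV : ∀ {ts} → 2 ≤ length ts → length ts ≤ b → All (Valid b) ts →
          slackSum b ts ≡ b → Valid b (node ts)

Overslack : ℕ → ℕ → ℕ → Tree → Set
Overslack b k h t = Valid b t × deg t ≡ k × LeavesAt h t

d : ℕ → ℕ → ℕ → ℤ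
d b zero k = + k
d b (suc zero) k = (+ k *ℤ + b) - + b
d b (suc (suc δ)) k = + b *ℤ (d b (suc δ) k - d b δ k)

D : ℕ → ℕ → ℕ → ℤ
D b zero k = + k
D b (suc h) k = + k +ℤ + b *ℤ (d b h k - + 1)

-- Level by level, the slack condition says that the degrees at depth i + 1 sum to
-- b (nᵢ₊₁ − nᵢ), where nᵢ is the number of nodes at depth i and nᵢ₊₁ is the degree sum
-- at depth i. So (nᵢ) satisfies n₀ = 1, n₁ = k, nᵢ₊₂ = b (nᵢ₊₁ − nᵢ), i.e. d(δ,k) = n_{δ+1},
-- and the total degree n₁ + ⋯ + n_{h+1} telescopes to k + b (n_h − 1) = D(h,k).
-- For b ≥ 4 the invariant 0 < nᵢ, 2 nᵢ ≤ nᵢ₊₁ is preserved, so (nᵢ) increases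
-- strictly; by linearity of the recurrence the same argument applied to the difference
-- of the sequences for k′ and k shows that D grows with k.
module Submission where

open import Defs
open import Data.Nat using (ℕ; zero; suc; _≤_; _<_; z≤n; s≤s; _≤′_; ≤′-refl; ≤′-step)
import Data.Nat as ℕ
import Data.Nat.Properties as ℕₚ
import Data.Nat.Tactic.RingSolver as ℕ-Solver
open import Data.Integer using (ℤ; +_; 0ℤ; 1ℤ; -1ℤ; _+_; _*_; _-_; +<+; +≤+) renaming (_<_ to _<ℤ_; _≤_ to _≤ℤ_)
import Data.Integer.Properties as ℤₚ
open import Data.Integer.Tactic.RingSolver using (solve-∀)
open import Data.List using ([]; _∷_; length; map)
open import Data.Nat.ListAction using (sum)
open import Data.List.Relation.Unary.All as All using (All; []; _∷_)
open import Data.Product using (_×_; _,_)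
open import Relation.Binary.PropositionalEquality using (_≡_; refl; sym; trans; cong; cong₂; subst; subst₂; module ≡-Reasoning)

open ≡-Reasoning

-- Shifting the initial pair (instead of recursing twice) lets induction on n
-- generalise over the initial values.
lucas : ℕ → ℤ → ℤ → ℕ → ℤ
lucas b x₀ x₁ zero    = x₀
lucas b x₀ x₁ (suc n) = lucas b x₁ (+ b * (x₁ - x₀)) n

lucas-suc-suc : ∀ b x₀ x₁ n →
  lucas b x₀ x₁ (suc (suc n)) ≡ + b * (lucas b x₀ x₁ (suc n) - lucas b x₀ x₁ n)
lucas-suc-suc b x₀ x₁ zero    = refl
lucas-suc-suc b x₀ x₁ (suc n) = lucas-suc-suc b x₁ (+ b * (x₁ - x₀)) n

lucas-+ : ∀ b x₀ x₁ y₀ y₁ n →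
  lucas b (x₀ + y₀) (x₁ + y₁) n ≡ lucas b x₀ x₁ n + lucas b y₀ y₁ n
lucas-+ b x₀ x₁ y₀ y₁ zero    = refl
lucas-+ b x₀ x₁ y₀ y₁ (suc n) = begin
  lucas b (x₁ + y₁) (+ b * ((x₁ + y₁) - (x₀ + y₀))) n
    ≡⟨ cong (λ z → lucas b (x₁ + y₁) z n) (distrib (+ b) x₀ x₁ y₀ y₁) ⟩
  lucas b (x₁ + y₁) (+ b * (x₁ - x₀) + + b * (y₁ - y₀)) n
    ≡⟨ lucas-+ b x₁ (+ b * (x₁ - x₀)) y₁ (+ b * (y₁ - y₀)) n ⟩
  lucas b x₁ (+ b * (x₁ - x₀)) n + lucas b y₁ (+ b * (y₁ - y₀)) n ∎
  where
  distrib : ∀ B x₀ x₁ y₀ y₁ → B * ((x₁ + y₁) - (x₀ + y₀)) ≡ B * (x₁ - x₀) + B * (y₁ - y₀)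
  distrib = solve-∀

lucas-zero : ∀ b n → lucas b 0ℤ 0ℤ n ≡ 0ℤ
lucas-zero b zero    = refl
lucas-zero b (suc n) = trans (cong (λ z → lucas b 0ℤ z n) (B*0 (+ b))) (lucas-zero b n)
  where
  B*0 : ∀ B → B * (0ℤ - 0ℤ) ≡ 0ℤ
  B*0 = solve-∀

d≡lucas : ∀ b k δ → d b δ k ≡ lucas b 1ℤ (+ k) (suc δ)
d≡lucas b k zero          = refl
d≡lucas b k (suc zero)    = commute (+ k) (+ b)
  where
  commute : ∀ K B → K * B - B ≡ B * (K - 1ℤ)
  commute = solve-∀
d≡lucas b k (suc (suc δ)) = begin
  + b * (d b (suc δ) k - d b δ k)
    ≡⟨ cong (λ x → + b * (x - d b δ k)) (d≡lucas b k (suc δ)) ⟩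
  + b * (lucas b 1ℤ (+ k) (suc (suc δ)) - d b δ k)
    ≡⟨ cong (λ x → + b * (lucas b 1ℤ (+ k) (suc (suc δ)) - x)) (d≡lucas b k δ) ⟩
  + b * (lucas b 1ℤ (+ k) (suc (suc δ)) - lucas b 1ℤ (+ k) (suc δ))
    ≡⟨ sym (lucas-suc-suc b 1ℤ (+ k) (suc δ)) ⟩
  lucas b 1ℤ (+ k) (suc (suc (suc δ))) ∎

D≡lucas : ∀ b h k → D b h k ≡ + k + + b * (lucas b 1ℤ (+ k) h - 1ℤ)
D≡lucas b zero    k = plus-zero (+ k) (+ b)
  where
  plus-zero : ∀ K B → K ≡ K + B * (1ℤ - 1ℤ)
  plus-zero = solve-∀
D≡lucas b (suc h) k = cong (λ x → + k + + b * (x - 1ℤ)) (d≡lucas b k h)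

deg≤ : ∀ {b t} → Valid b t → deg t ≤ b
deg≤ (leafV ks≤b)       = ks≤b
deg≤ (nodeV _ ts≤b _ _) = ts≤b

slackSum+sum-deg : ∀ {b} ts → All (λ t → deg t ≤ b) ts →
  slackSum b ts ℕ.+ sum (map deg ts) ≡ length ts ℕ.* b
slackSum+sum-deg          []       []            = refl
slackSum+sum-deg {b} (t ∷ ts) (t≤b ∷ ts≤b) = begin
  (b ℕ.∸ deg t ℕ.+ slackSum b ts) ℕ.+ (deg t ℕ.+ sum (map deg ts))
    ≡⟨ interchange (b ℕ.∸ deg t) (slackSum b ts) (deg t) (sum (map deg ts)) ⟩
  (b ℕ.∸ deg t ℕ.+ deg t) ℕ.+ (slackSum b ts ℕ.+ sum (map deg ts))
    ≡⟨ cong₂ ℕ._+_ (ℕₚ.m∸n+n≡m t≤b) (slackSum+sum-deg ts ts≤b) ⟩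
  b ℕ.+ length ts ℕ.* b ∎
  where
  interchange : ∀ w x y z → (w ℕ.+ x) ℕ.+ (y ℕ.+ z) ≡ (w ℕ.+ y) ℕ.+ (x ℕ.+ z)
  interchange = ℕ-Solver.solve-∀

sum-deg-children : ∀ {b ts} → All (Valid b) ts → slackSum b ts ≡ b →
  + sum (map deg ts) ≡ + b * (+ length ts - 1ℤ)
sum-deg-children {b} {ts} valid slack = begin
  + S                          ≡⟨ cancel (+ S) (+ b) ⟩
  (+ b + + S) - + b            ≡⟨ cong (λ n → + n - + b) b+S≡L*b ⟩
  + (length ts ℕ.* b) - + b    ≡⟨ cong (_- + b) (ℤₚ.pos-* (length ts) b) ⟩
  + length ts * + b - + b      ≡⟨ factor (+ length ts) (+ b) ⟩
  + b * (+ length ts - 1ℤ)     ∎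
  where
  S : ℕ
  S = sum (map deg ts)
  b+S≡L*b : b ℕ.+ S ≡ length ts ℕ.* b
  b+S≡L*b = trans (cong (ℕ._+ S) (sym slack)) (slackSum+sum-deg ts (All.map deg≤ valid))
  cancel : ∀ x B → x ≡ (B + x) - B
  cancel = solve-∀
  factor : ∀ L B → L * B - B ≡ B * (L - 1ℤ)
  factor = solve-∀

mutual
  totalDeg≡lucas : ∀ {b h t} → Valid b t → LeavesAt h t →
    + totalDeg t ≡ + deg t + + b * (lucas b 1ℤ (+ deg t) h - 1ℤ)
  totalDeg≡lucas {b} {t = leaf ks} (leafV _) leafAt = plus-zero (+ length ks) (+ b)
    where
    plus-zero : ∀ K B → K ≡ K + B * (1ℤ - 1ℤ)
    plus-zero = solve-∀
  totalDeg≡lucas {b} {suc h} {node ts} (nodeV _ _ valid slack) (nodeAt leaves) = begin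
    L + + totalDegs ts
      ≡⟨ cong (λ x → L + x) (totalDegs≡lucas valid leaves) ⟩
    L + (S + B * (lucas b L S h - L))
      ≡⟨ cong (λ s → L + (s + B * (lucas b L s h - L))) S≡ ⟩
    L + (B * (L - 1ℤ) + B * (lucas b L (B * (L - 1ℤ)) h - L))
      ≡⟨ telescope L B (lucas b L (B * (L - 1ℤ)) h) ⟩
    L + B * (lucas b L (B * (L - 1ℤ)) h - 1ℤ) ∎
    where
    L : ℤ
    L = + length ts
    B : ℤ
    B = + b
    S : ℤ
    S = + sum (map deg ts)
    S≡ : S ≡ B * (L - 1ℤ)
    S≡ = sum-deg-children valid slack
    telescope : ∀ L B X → L + (B * (L - 1ℤ) + B * (X - L)) ≡ L + B * (X - 1ℤ)
    telescope = solve-∀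

  totalDegs≡lucas : ∀ {b h ts} → All (Valid b) ts → All (LeavesAt h) ts →
    + totalDegs ts ≡ + sum (map deg ts) + + b * (lucas b (+ length ts) (+ sum (map deg ts)) h - + length ts)
  totalDegs≡lucas {b} {h} [] [] = begin
    0ℤ                               ≡⟨ plus-zero (+ b) ⟩
    0ℤ + + b * (0ℤ - 0ℤ)             ≡⟨ cong (λ x → 0ℤ + + b * (x - 0ℤ)) (sym (lucas-zero b h)) ⟩
    0ℤ + + b * (lucas b 0ℤ 0ℤ h - 0ℤ) ∎
    where
    plus-zero : ∀ B → 0ℤ ≡ 0ℤ + B * (0ℤ - 0ℤ)
    plus-zero = solve-∀
  totalDegs≡lucas {b} {h} {t ∷ ts} (v ∷ valid) (l ∷ leaves) = begin
    + totalDeg t + + totalDegs ts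
      ≡⟨ cong₂ _+_ (totalDeg≡lucas v l) (totalDegs≡lucas valid leaves) ⟩
    (+ deg t + B * (X₁ - 1ℤ)) + (S + B * (X₂ - L))
      ≡⟨ collect (+ deg t) S B X₁ X₂ L ⟩
    (+ deg t + S) + B * ((X₁ + X₂) - (1ℤ + L))
      ≡⟨ cong (λ x → (+ deg t + S) + B * (x - (1ℤ + L))) (sym (lucas-+ b 1ℤ (+ deg t) L S h)) ⟩
    (+ deg t + S) + B * (lucas b (1ℤ + L) (+ deg t + S) h - (1ℤ + L)) ∎
    where
    B : ℤ
    B = + b
    L : ℤ
    L = + length ts
    S : ℤ
    S = + sum (map deg ts)
    X₁ : ℤ
    X₁ = lucas b 1ℤ (+ deg t) h
    X₂ : ℤ
    X₂ = lucas b L S h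
    collect : ∀ x S B X₁ X₂ L →
      (x + B * (X₁ - 1ℤ)) + (S + B * (X₂ - L)) ≡ (x + S) + B * ((X₁ + X₂) - (1ℤ + L))
    collect = solve-∀

totalDeg≡D : ∀ b k h t → Overslack b k h t → + totalDeg t ≡ D b h k
totalDeg≡D b k h t (valid , refl , leaves) =
  trans (totalDeg≡lucas valid leaves) (sym (D≡lucas b h (deg t)))

-- 0 < x₀ and 2 x₀ ≤ x₁, with the witnesses in ℕ.
data Doubling : ℤ → ℤ → Set where
  doubling : ∀ a p → Doubling (+ suc a) (+ (suc a ℕ.+ suc a ℕ.+ p))

Doubling⇒< : ∀ {x₀ x₁} → Doubling x₀ x₁ → x₀ <ℤ x₁
Doubling⇒< (doubling a p) = +<+ (ℕₚ.<-≤-trans (ℕₚ.m<m+n (suc a) (s≤s z≤n)) (ℕₚ.m≤m+n _ p))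

Doubling⇒pos : ∀ {x₀ x₁} → Doubling x₀ x₁ → 0ℤ <ℤ x₀
Doubling⇒pos (doubling a p) = +<+ (s≤s z≤n)

doubling-start : ∀ {b} → 2 ≤ b → ∀ j → Doubling (+ suc j) (+ b * + suc j)
doubling-start {suc (suc m)} (s≤s (s≤s z≤n)) j =
  subst (Doubling (+ suc j)) (sym (trans (sym (ℤₚ.pos-* (2 ℕ.+ m) (suc j))) (cong +_ (expand m j))))
    (doubling j (m ℕ.* suc j))
  where
  expand : ∀ m j → (2 ℕ.+ m) ℕ.* suc j ≡ suc j ℕ.+ suc j ℕ.+ m ℕ.* suc j
  expand = ℕ-Solver.solve-∀

-- 2 x₁ ≤ b (x₁ − x₀) because x₁ − x₀ ≥ x₁ / 2 and b ≥ 4.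
doubling-step : ∀ {b x₀ x₁} → 4 ≤ b → Doubling x₀ x₁ → Doubling x₁ (+ b * (x₁ - x₀))
doubling-step {b@(suc (suc (suc (suc m))))} (s≤s (s≤s (s≤s (s≤s z≤n)))) (doubling a p) =
  subst (Doubling (+ c)) (sym next≡) (doubling (a ℕ.+ suc a ℕ.+ p) (p ℕ.+ p ℕ.+ m ℕ.* (suc a ℕ.+ p)))
  where
  c : ℕ
  c = suc a ℕ.+ suc a ℕ.+ p
  cancel : ∀ A P → (A + A + P) - A ≡ A + P
  cancel = solve-∀
  expand : ∀ m a p → (4 ℕ.+ m) ℕ.* (suc a ℕ.+ p)
         ≡ (suc a ℕ.+ suc a ℕ.+ p) ℕ.+ (suc a ℕ.+ suc a ℕ.+ p) ℕ.+ (p ℕ.+ p ℕ.+ m ℕ.* (suc a ℕ.+ p))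
  expand = ℕ-Solver.solve-∀
  next≡ : + b * (+ c - + suc a) ≡ + (c ℕ.+ c ℕ.+ (p ℕ.+ p ℕ.+ m ℕ.* (suc a ℕ.+ p)))
  next≡ = begin
    + b * (+ c - + suc a)      ≡⟨ cong (+ b *_) (cancel (+ suc a) (+ p)) ⟩
    + b * + (suc a ℕ.+ p)      ≡⟨ ℤₚ.pos-* b (suc a ℕ.+ p) ⟨
    + (b ℕ.* (suc a ℕ.+ p))    ≡⟨ cong +_ (expand m a p) ⟩
    + (c ℕ.+ c ℕ.+ (p ℕ.+ p ℕ.+ m ℕ.* (suc a ℕ.+ p))) ∎

lucas-doubling : ∀ {b x₀ x₁} → 4 ≤ b → Doubling x₀ x₁ →
  ∀ n → Doubling (lucas b x₀ x₁ n) (lucas b x₀ x₁ (suc n))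
lucas-doubling b≥4 dbl zero    = dbl
lucas-doubling b≥4 dbl (suc n) = lucas-doubling b≥4 (doubling-step b≥4 dbl) n

lucas-strictMono : ∀ {b x₀ x₁} → 4 ≤ b → Doubling x₀ x₁ →
  ∀ {m n} → m < n → lucas b x₀ x₁ m <ℤ lucas b x₀ x₁ n
lucas-strictMono {b} {x₀} {x₁} b≥4 dbl {m} m<n = go (ℕₚ.≤⇒≤′ m<n)
  where
  go : ∀ {n} → suc m ≤′ n → lucas b x₀ x₁ m <ℤ lucas b x₀ x₁ n
  go ≤′-refl          = Doubling⇒< (lucas-doubling b≥4 dbl m)
  go (≤′-step {n} m<n) = ℤₚ.<-trans (go m<n) (Doubling⇒< (lucas-doubling b≥4 dbl n))

lucas-from-zero-nonNeg : ∀ {b} → 4 ≤ b → ∀ j h → 0ℤ ≤ℤ lucas b 0ℤ (+ suc j) h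
lucas-from-zero-nonNeg b≥4 j zero        = +≤+ z≤n
lucas-from-zero-nonNeg {b} b≥4 j (suc h) =
  ℤₚ.<⇒≤ (Doubling⇒pos (lucas-doubling b≥4 start h))
  where
  start : Doubling (+ suc j) (+ b * (+ suc j - 0ℤ))
  start = subst (λ x → Doubling (+ suc j) (+ b * x)) (sym (ℤₚ.+-identityʳ (+ suc j)))
            (doubling-start (ℕₚ.≤-trans (s≤s (s≤s z≤n)) b≥4) j)

D-strictMono-height : ∀ {b k h h′} → 4 ≤ b → 2 ≤ k → h < h′ → D b h k <ℤ D b h′ k
D-strictMono-height {b} {k@(suc (suc k₀))} {h} {h′} b≥4@(s≤s _) (s≤s (s≤s z≤n)) h<h′ =
  subst₂ _<ℤ_ (sym (D≡lucas b h k)) (sym (D≡lucas b h′ k))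
    (ℤₚ.+-monoʳ-< (+ k) (ℤₚ.*-monoˡ-<-pos (+ b) (ℤₚ.+-monoˡ-< (-1ℤ)
      (lucas-strictMono b≥4 (doubling 0 k₀) h<h′))))

D-+-degree : ∀ b h k c → D b h (k ℕ.+ c) ≡ D b h k + (+ c + + b * lucas b 0ℤ (+ c) h)
D-+-degree b h k c = begin
  D b h (k ℕ.+ c)
    ≡⟨ D≡lucas b h (k ℕ.+ c) ⟩
  + (k ℕ.+ c) + + b * (lucas b 1ℤ (+ (k ℕ.+ c)) h - 1ℤ)
    ≡⟨ cong (λ x → + (k ℕ.+ c) + + b * (x - 1ℤ)) (lucas-+ b 1ℤ (+ k) 0ℤ (+ c) h) ⟩
  + (k ℕ.+ c) + + b * ((X + Y) - 1ℤ)
    ≡⟨ split (+ k) (+ c) (+ b) X Y ⟩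
  (+ k + + b * (X - 1ℤ)) + (+ c + + b * Y)
    ≡⟨ cong (_+ (+ c + + b * Y)) (D≡lucas b h k) ⟨
  D b h k + (+ c + + b * Y) ∎
  where
  X : ℤ
  X = lucas b 1ℤ (+ k) h
  Y : ℤ
  Y = lucas b 0ℤ (+ c) h
  split : ∀ K C B X Y → (K + C) + B * ((X + Y) - 1ℤ) ≡ (K + B * (X - 1ℤ)) + (C + B * Y)
  split = solve-∀

D-strictMono-degree : ∀ {b} → 4 ≤ b → ∀ h {k k′} → k < k′ → D b h k <ℤ D b h k′
D-strictMono-degree {b} b≥4 h {k} k<k′ with ℕₚ.m≤n⇒∃[o]m+o≡n k<k′
... | j , refl = subst₂ _<ℤ_ (ℤₚ.+-identityʳ (D b h k)) (sym k′≡)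
  (ℤₚ.+-monoʳ-< (D b h k) (ℤₚ.+-mono-<-≤ (+<+ (s≤s z≤n)) b*Y≥0))
  where
  b*Y≥0 : 0ℤ ≤ℤ + b * lucas b 0ℤ (+ suc j) h
  b*Y≥0 = subst (_≤ℤ + b * lucas b 0ℤ (+ suc j) h) (ℤₚ.*-zeroʳ (+ b))
            (ℤₚ.*-monoˡ-≤-nonNeg (+ b) (lucas-from-zero-nonNeg b≥4 j h))
  k′≡ : D b h (suc k ℕ.+ j) ≡ D b h k + (+ suc j + + b * lucas b 0ℤ (+ suc j) h)
  k′≡ = trans (cong (λ n → D b h n) (sym (ℕₚ.+-suc k j))) (D-+-degree b h k (suc j))

lemma7 : (b : ℕ) → 4 < b →
    ((k h : ℕ) (t : Tree) → Overslack b k h t → + totalDeg t ≡ D b h k)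
    × ((k h h′ : ℕ) → 2 ≤ k → h < h′ → D b h k <ℤ D b h′ k)
    × ((h k k′ : ℕ) → 2 ≤ k → k < k′ → D b h k <ℤ D b h k′)
lemma7 b b>4 =
  totalDeg≡D b ,
  (λ _ _ _ k≥2 h<h′ → D-strictMono-height b≥4 k≥2 h<h′) ,
  (λ h _ _ _ k<k′ → D-strictMono-degree b≥4 h k<k′)
  where
  b≥4 : 4 ≤ b
  b≥4 = ℕₚ.<⇒≤ b>4
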